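{- Let $n\ge 1$ and let $\alpha=(a_1,a_2,\ldots,a_n)$ be a Fubini ranking with $n$ competitors, and let $1=r_1<r_2<\cdots<r_k$ be the distinct values (ranks) appearing in $\alpha$. Then \[\mathrm{Lucky}(\alpha)=\{i\in[n]: a_i\neq a_j \text{ for all } j<i\}.\] Moreover, $\mathrm{lucky}(\alpha)=k$, the number of distinct ranks appearing in $\alpha$.
   Context: $[n]=\{1,\ldots,n\}$. A Fubini ranking with $n$ competitors is a tuple $\alpha=(a_1,\ldots,a_n)\in[n]^n$ encoding a ranking of $n$ competitors with ties allowed: if $k$ competitors share rank $i$, then ranks $i+1,\ldots,i+k-1$ are omitted. Equivalently, $a_i=1+|\{j\in[n]: a_j<a_i\}|$ for every $i$. Lucky cars: given $\alpha\in[n]^n$, cars $1,2,\ldots,n$ enter, in this order, a one-way street with spots $1,\ldots,n$; car $i$ drives to spot $a_i$ and parks there if it is free, otherwise it parks in the first free spot after $a_i$ (for Fubini rankings every car parks). Car $i$ is lucky if it parks in spot $a_i$. $\mathrm{Lucky}(\alpha)$ is the set of lucky cars and $\mathrm{lucky}(\alpha)=|\mathrm{Lucky}(\alpha)|$. -}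

module Defs where

open import Data.Nat using (ℕ; zero; suc; _≤_; _<_; _≤?_; _<?_; _≟_)
open import Data.Fin using (Fin; toℕ)
open import Data.Vec using (Vec; []; _∷_; lookup; toList)
open import Data.List using (List; length; filter; deduplicate)
import Data.List as L
open import Data.List.Membership.DecPropositional (_≟_) using (_∈?_)
open import Data.Fin.Base using () renaming (_<_ to _<ᶠ_)
open import Data.Maybe using (Maybe; just; nothing)
open import Data.Bool using (if_then_else_)
open import Data.List using (allFin) public
open import Relation.Nullary using (does; ¬_)
open import Relation.Binary.PropositionalEquality using (_≡_)

-- The ranking α = (a₁,…,aₙ) is a vector; car i (as Fin n, 0-based index) has
-- preference  lookup α i.

countBelow : ∀ {n} → Vec ℕ n → ℕ → ℕ
countBelow {n} α v = length (filter (λ j → lookup α j <? v) (allFin n))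

IsFubini : ∀ n → Vec ℕ n → Set
IsFubini n α = ∀ (i : Fin n) →
  (1 ≤ lookup α i) × (lookup α i ≤ n) × (lookup α i ≡ suc (countBelow α (lookup α i)))
  where open import Data.Product using (_×_)

-- first free spot ≥ a among spots 1..n (occupied spots in occ);
-- nothing if the car leaves the street.  Fuel f bounds the search.
firstFree : (n : ℕ) → List ℕ → ℕ → ℕ → Maybe ℕ
firstFree n occ a zero = nothing
firstFree n occ a (suc f) =
  if does (a ≤? n)
  then (if does (a ∈? occ) then firstFree n occ (suc a) f else just a)
  else nothing

parkFrom : (n : ℕ) → List ℕ → ∀ {m} → Vec ℕ m → Vec (Maybe ℕ) m
parkFrom n occ [] = []
parkFrom n occ (a ∷ as) with firstFree n occ a (suc n)
... | just s  = just s ∷ parkFrom n (s L.∷ occ) as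
... | nothing = nothing ∷ parkFrom n occ as

parking : ∀ {n} → Vec ℕ n → Vec (Maybe ℕ) n
parking {n} α = parkFrom n L.[] α

Lucky : ∀ {n} → Vec ℕ n → Fin n → Set
Lucky α i = lookup (parking α) i ≡ just (lookup α i)

lucky : ∀ {n} → Vec ℕ n → ℕ
lucky {n} α = length (filter (λ i → Data.Maybe.Properties.≡-dec _≟_ (lookup (parking α) i) (just (lookup α i))) (allFin n))
  where import Data.Maybe.Properties

distinctValues : ∀ {n} → Vec ℕ n → ℕ
distinctValues α = length (deduplicate _≟_ (toList α))

-- By the Fubini condition a value p occurring M p times in α satisfies
-- p = 1 + #{j : a_j < p}, so the blocks [p, p + M p) of the occurring values are
-- pairwise disjoint and lie inside [1, n]. Induction over the cars then shows that
-- a car whose preference p was already chosen by c earlier cars parks in spot p + c: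
-- the spots p, …, p + c - 1 hold exactly those earlier cars, and p + c lies in no
-- other block. Hence a car is lucky iff its preference is new, and the lucky cars
-- correspond to the distinct values of α.
module Submission where

open import Defs
open import Data.Nat using (ℕ; _≤_)
open import Data.Fin using (Fin) renaming (_<_ to _<ᶠ_)
open import Data.Vec using (Vec; lookup)
open import Data.Product using (_×_)
open import Relation.Binary.PropositionalEquality using (_≡_; _≢_)
open import Function.Bundles using (_⇔_)

open import Level using (Level)
open import Data.Bool using (true; false)
open import Data.Nat using (zero; suc; _+_; _<_; _≟_; _<?_; _≤?_; z≤n; s≤s; s≤s⁻¹; z<s)
open import Data.Nat.Properties
open import Data.Fin using () renaming (zero to fzero; suc to fsuc)
open import Data.Vec using ([]; _∷_; toList)
open import Data.Vec.Properties using (tabulate∘lookup; length-toList)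
import Data.Vec.Relation.Unary.All as VecAll
open import Data.Vec.Relation.Unary.All.Properties using (tabulate⁺)
open import Data.Vec.Membership.Propositional.Properties using (∈-toList⁻)
open import Data.List using (List; []; _∷_; length; filter; map; tabulate; deduplicate)
import Data.List.Properties as List
open import Data.List.Relation.Unary.All using (universal)
open import Data.List.Relation.Unary.All.Properties using (¬Any⇒All¬)
open import Data.List.Relation.Unary.Any using (here; there)
open import Data.List.Relation.Binary.Sublist.Heterogeneous.Properties
  using (length-mono-≤; ⊆-filter-Sublist)
open import Data.List.Relation.Binary.Sublist.Propositional using (⊆-refl)
open import Data.List.Membership.DecPropositional (_≟_) using (_∈_; _∉_; _∈?_; _∉?_)
open import Data.Maybe using (Maybe; just)
open import Data.Maybe.Properties using (just-injective; ≡-dec)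
open import Data.Product using (∃-syntax; _,_; proj₁; proj₂)
open import Data.Sum using (_⊎_; inj₁; inj₂; [_,_]′)
open import Function using (_∘_; id)
open import Function.Bundles using (mk⇔; Equivalence)
import Function.Properties.Equivalence as ⇔
open import Relation.Binary.Definitions using (tri<; tri≈; tri>)
open import Relation.Binary.PropositionalEquality
  using (refl; sym; trans; cong; cong₂; subst; ≢-sym; module ≡-Reasoning)
open import Relation.Nullary using (does; yes; no; ¬_; ¬?; contradiction)
open import Relation.Nullary.Decidable using (dec-true; dec-false; does-⇔)
open import Relation.Unary using (Pred; Decidable; _⊆_; _≐_)
open import Relation.Unary.Properties using (_∩?_)

open Equivalence using (to; from)

private variable
  ℓ ℓ′ : Level
  A B : Set ℓ
  m n : ℕ

count : {P : Pred A ℓ} → Decidable P → List A → ℕ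
count P? = length ∘ filter P?

module _ {P : Pred A ℓ} (P? : Decidable P) where

  count-accept : ∀ {x xs} → P x → count P? (x ∷ xs) ≡ suc (count P? xs)
  count-accept Px = cong length (List.filter-accept P? Px)

  count-reject : ∀ {x xs} → ¬ P x → count P? (x ∷ xs) ≡ count P? xs
  count-reject ¬Px = cong length (List.filter-reject P? ¬Px)

  filter-map : (f : B → A) (xs : List B) → filter P? (map f xs) ≡ map f (filter (P? ∘ f) xs)
  filter-map f [] = refl
  filter-map f (x ∷ xs) with does (P? (f x))
  ... | true  = cong (f x ∷_) (filter-map f xs)
  ... | false = filter-map f xs

  count-map : (f : B → A) (xs : List B) → count P? (map f xs) ≡ count (P? ∘ f) xs
  count-map f xs = trans (cong length (filter-map f xs)) (List.length-map f (filter (P? ∘ f) xs))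

module _ {P : Pred A ℓ} {Q : Pred A ℓ′} (P? : Decidable P) (Q? : Decidable Q) where

  filter-filter : (xs : List A) → filter P? (filter Q? xs) ≡ filter (P? ∩? Q?) xs
  filter-filter [] = refl
  filter-filter (x ∷ xs) with does (Q? x)
  ... | true with does (P? x)
  ...   | true  = cong (x ∷_) (filter-filter xs)
  ...   | false = filter-filter xs
  filter-filter (x ∷ xs) | false with does (P? x)
  ...   | true  = filter-filter xs
  ...   | false = filter-filter xs

  count-filter : (xs : List A) → count P? (filter Q? xs) ≡ count (P? ∩? Q?) xs
  count-filter xs = cong length (filter-filter xs)

  count-mono : P ⊆ Q → (xs : List A) → count P? xs ≤ count Q? xs
  count-mono P⊆Q xs = length-mono-≤ (⊆-filter-Sublist P? Q? (λ { refl → P⊆Q }) (⊆-refl {x = xs}))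

count-∷-cong : ∀ {P : Pred A ℓ} {Q : Pred B ℓ′} (P? : Decidable P) (Q? : Decidable Q) {x y xs ys} →
               does (P? x) ≡ does (Q? y) → count P? xs ≡ count Q? ys → count P? (x ∷ xs) ≡ count Q? (y ∷ ys)
count-∷-cong P? Q? {x} {y} eq ih with does (P? x) | does (Q? y) | eq
... | true  | .true  | refl = cong suc ih
... | false | .false | refl = ih

multiplicity : ℕ → List ℕ → ℕ
multiplicity x = count (x ≟_)

countLess : ℕ → List ℕ → ℕ
countLess v = count (_<? v)

multiplicity-∷-≡ : ∀ x xs → multiplicity x (x ∷ xs) ≡ suc (multiplicity x xs)
multiplicity-∷-≡ x xs = count-accept (x ≟_) refl

multiplicity-∷-≢ : ∀ {x y} xs → x ≢ y → multiplicity x (y ∷ xs) ≡ multiplicity x xs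
multiplicity-∷-≢ xs = count-reject (_ ≟_)

multiplicity-≤-∷ : ∀ p a xs → multiplicity p xs ≤ multiplicity p (a ∷ xs)
multiplicity-≤-∷ p a xs with p ≟ a
... | yes refl = ≤-trans (n≤1+n _) (≤-reflexive (sym (multiplicity-∷-≡ p xs)))
... | no p≢a   = ≤-reflexive (sym (multiplicity-∷-≢ xs p≢a))

multiplicity≡0⇔∉ : ∀ {x xs} → multiplicity x xs ≡ 0 ⇔ x ∉ xs
multiplicity≡0⇔∉ {x} {xs} = mk⇔
  (λ m≡0 x∈xs → <⇒≢ (List.filter-some (x ≟_) x∈xs) (sym m≡0))
  (λ x∉xs → cong length (List.filter-none (x ≟_) (¬Any⇒All¬ xs x∉xs)))

0<multiplicity⇒∈ : ∀ {x xs} → 0 < multiplicity x xs → x ∈ xs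
0<multiplicity⇒∈ {x} {xs} pos with x ∈? xs
... | yes x∈xs = x∈xs
... | no  x∉xs = contradiction (from multiplicity≡0⇔∉ x∉xs) (>⇒≢ pos)

multiplicity-move : ∀ q a xs ys →
  multiplicity q (a ∷ xs) + multiplicity q ys ≡ multiplicity q xs + multiplicity q (a ∷ ys)
multiplicity-move q a xs ys with q ≟ a
... | yes refl = begin
  multiplicity q (q ∷ xs) + multiplicity q ys   ≡⟨ cong (_+ multiplicity q ys) (multiplicity-∷-≡ q xs) ⟩
  suc (multiplicity q xs + multiplicity q ys)   ≡⟨ +-suc (multiplicity q xs) (multiplicity q ys) ⟨
  multiplicity q xs + suc (multiplicity q ys)   ≡⟨ cong (multiplicity q xs +_) (multiplicity-∷-≡ q ys) ⟨
  multiplicity q xs + multiplicity q (q ∷ ys)   ∎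
  where open ≡-Reasoning
... | no q≢a = cong₂ _+_ (multiplicity-∷-≢ xs q≢a) (sym (multiplicity-∷-≢ ys q≢a))

countLess+multiplicity : ∀ p xs → countLess p xs + multiplicity p xs ≡ countLess (suc p) xs
countLess+multiplicity p [] = refl
countLess+multiplicity p (y ∷ xs) with <-cmp y p
... | tri< y<p _ _ = begin
  countLess p (y ∷ xs) + multiplicity p (y ∷ xs)
    ≡⟨ cong₂ _+_ (count-accept (_<? p) y<p) (multiplicity-∷-≢ xs (>⇒≢ y<p)) ⟩
  suc (countLess p xs + multiplicity p xs)   ≡⟨ cong suc (countLess+multiplicity p xs) ⟩
  suc (countLess (suc p) xs)                 ≡⟨ count-accept (_<? suc p) (m<n⇒m<1+n y<p) ⟨
  countLess (suc p) (y ∷ xs)                 ∎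
  where open ≡-Reasoning
... | tri≈ _ refl _ = begin
  countLess y (y ∷ xs) + multiplicity y (y ∷ xs)
    ≡⟨ cong₂ _+_ (count-reject (_<? y) (n≮n y)) (multiplicity-∷-≡ y xs) ⟩
  countLess y xs + suc (multiplicity y xs)   ≡⟨ +-suc (countLess y xs) (multiplicity y xs) ⟩
  suc (countLess y xs + multiplicity y xs)   ≡⟨ cong suc (countLess+multiplicity y xs) ⟩
  suc (countLess (suc y) xs)                 ≡⟨ count-accept (_<? suc y) (n<1+n y) ⟨
  countLess (suc y) (y ∷ xs)                 ∎
  where open ≡-Reasoning
... | tri> _ _ p<y = begin
  countLess p (y ∷ xs) + multiplicity p (y ∷ xs)
    ≡⟨ cong₂ _+_ (count-reject (_<? p) (<⇒≯ p<y)) (multiplicity-∷-≢ xs (<⇒≢ p<y)) ⟩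
  countLess p xs + multiplicity p xs         ≡⟨ countLess+multiplicity p xs ⟩
  countLess (suc p) xs                       ≡⟨ count-reject (_<? suc p) (≤⇒≯ p<y) ⟨
  countLess (suc p) (y ∷ xs)                 ∎
  where open ≡-Reasoning

countLess-mono : ∀ {p q} → p ≤ q → ∀ xs → countLess p xs ≤ countLess q xs
countLess-mono p≤q = count-mono (_<? _) (_<? _) (λ x<p → <-≤-trans x<p p≤q)

InRange : ℕ → ℕ → ℕ → Set
InRange p k s = p ≤ s × s < p + k

InRange⇒0< : ∀ {p k s} → InRange p k s → 0 < k
InRange⇒0< {p} {zero} (p≤s , s<p+0) = contradiction (subst (_ <_) (+-identityʳ p) s<p+0) (≤⇒≯ p≤s)
InRange⇒0< {k = suc k} _ = z<s

record BlockLayout (n : ℕ) (M : ℕ → ℕ) : Set where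
  field
    block-fits      : ∀ {p} → 0 < M p → p + M p ≤ suc n
    blocks-disjoint : ∀ {p q s} → InRange p (M p) s → InRange q (M q) s → p ≡ q

module Ranked (xs : List ℕ) (rank : ∀ {p} → p ∈ xs → p ≡ suc (countLess p xs)) where

  private
    M : ℕ → ℕ
    M p = multiplicity p xs

  block-end : ∀ {p} → 0 < M p → p + M p ≡ suc (countLess (suc p) xs)
  block-end {p} pos = begin
    p + M p                      ≡⟨ cong (_+ M p) (rank (0<multiplicity⇒∈ pos)) ⟩
    suc (countLess p xs + M p)   ≡⟨ cong suc (countLess+multiplicity p xs) ⟩
    suc (countLess (suc p) xs)   ∎
    where open ≡-Reasoning

  block-precedes : ∀ {p q} → 0 < M p → 0 < M q → p < q → p + M p ≤ q
  block-precedes {p} {q} posp posq p<q = begin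
    p + M p                      ≡⟨ block-end posp ⟩
    suc (countLess (suc p) xs)   ≤⟨ s≤s (countLess-mono p<q xs) ⟩
    suc (countLess q xs)         ≡⟨ rank (0<multiplicity⇒∈ posq) ⟨
    q                            ∎
    where open ≤-Reasoning

  overlap⇒¬< : ∀ {p q s} → InRange p (M p) s → InRange q (M q) s → ¬ p < q
  overlap⇒¬< inP@(_ , s<p+M) inQ@(q≤s , _) p<q =
    <⇒≱ s<p+M (≤-trans (block-precedes (InRange⇒0< inP) (InRange⇒0< inQ) p<q) q≤s)

  blockLayout : BlockLayout (length xs) M
  blockLayout = record { block-fits = fits ; blocks-disjoint = disjoint }
    where
    fits : ∀ {p} → 0 < M p → p + M p ≤ suc (length xs)
    fits {p} pos = subst (_≤ suc (length xs)) (sym (block-end {p} pos)) (s≤s (List.length-filter (_<? _) xs))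
    disjoint : ∀ {p q s} → InRange p (M p) s → InRange q (M q) s → p ≡ q
    disjoint {p} {q} inP inQ with <-cmp p q
    ... | tri< p<q _ _ = contradiction p<q (overlap⇒¬< inP inQ)
    ... | tri≈ _ p≡q _ = p≡q
    ... | tri> _ _ q<p = contradiction q<p (overlap⇒¬< inQ inP)

tabulate-lookup : (α : Vec A n) → tabulate (lookup α) ≡ toList α
tabulate-lookup []      = refl
tabulate-lookup (a ∷ α) = cong (a ∷_) (tabulate-lookup α)

countBelow≡countLess : (α : Vec ℕ n) (v : ℕ) → countBelow α v ≡ countLess v (toList α)
countBelow≡countLess {n} α v = begin
  count ((_<? v) ∘ lookup α) (allFin n)   ≡⟨ count-map (_<? v) (lookup α) (allFin n) ⟨
  countLess v (map (lookup α) (allFin n)) ≡⟨ cong (countLess v) (List.map-tabulate id (lookup α)) ⟩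
  countLess v (tabulate (lookup α))       ≡⟨ cong (countLess v) (tabulate-lookup α) ⟩
  countLess v (toList α)                  ∎
  where open ≡-Reasoning

fubini-rank : ∀ {α : Vec ℕ n} → IsFubini n α → ∀ {p} → p ∈ toList α → p ≡ suc (countLess p (toList α))
fubini-rank {α = α} fubini p∈α = VecAll.lookup ranks (∈-toList⁻ p∈α)
  where
  ranks : VecAll.All (λ p → p ≡ suc (countLess p (toList α))) α
  ranks = subst (VecAll.All _) (tabulate∘lookup α) (tabulate⁺ λ i →
    trans (proj₂ (proj₂ (fubini i))) (cong suc (countBelow≡countLess α (lookup α i))))

fubini-blockLayout : ∀ {α : Vec ℕ n} → IsFubini n α → BlockLayout n (λ p → multiplicity p (toList α))
fubini-blockLayout {α = α} fubini = subst (λ m → BlockLayout m (λ p → multiplicity p (toList α)))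
  (length-toList α) (Ranked.blockLayout (toList α) (fubini-rank fubini))

Occupied : List ℕ → ℕ → Set
Occupied seen s = ∃[ p ] InRange p (multiplicity p seen) s

occupied-∷ : ∀ {a seen s} → (s ≡ a + multiplicity a seen ⊎ Occupied seen s) ⇔ Occupied (a ∷ seen) s
occupied-∷ {a} {seen} {s} = mk⇔ grow shrink
  where
  grow : s ≡ a + multiplicity a seen ⊎ Occupied seen s → Occupied (a ∷ seen) s
  grow (inj₁ refl) = a , m≤m+n a _ , +-monoʳ-< a (≤-reflexive (sym (multiplicity-∷-≡ a seen)))
  grow (inj₂ (p , p≤s , s<)) = p , p≤s , <-≤-trans s< (+-monoʳ-≤ p (multiplicity-≤-∷ p a seen))
  shrink : Occupied (a ∷ seen) s → s ≡ a + multiplicity a seen ⊎ Occupied seen s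
  shrink (p , p≤s , s<) with p ≟ a
  ... | no p≢a   = inj₂ (p , p≤s , subst (λ k → s < p + k) (multiplicity-∷-≢ seen p≢a) s<)
  ... | yes refl with m≤n⇒m<n∨m≡n (s≤s⁻¹ (subst (s <_) (+-suc p _)
                        (subst (λ k → s < p + k) (multiplicity-∷-≡ p seen) s<)))
  ...   | inj₁ s<p+c = inj₂ (p , p≤s , s<p+c)
  ...   | inj₂ s≡p+c = inj₁ s≡p+c

blockSpots : List ℕ → Vec ℕ m → Vec (Maybe ℕ) m
blockSpots seen []      = []
blockSpots seen (a ∷ S) = just (a + multiplicity a seen) ∷ blockSpots (a ∷ seen) S

module _ {n : ℕ} where

  firstFree-here : ∀ {occ a f} → a ≤ n → a ∉ occ → firstFree n occ a (suc f) ≡ just a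
  firstFree-here {occ} {a} a≤n a∉occ rewrite dec-true (a ≤? n) a≤n | dec-false (a ∈? occ) a∉occ = refl

  firstFree-skip : ∀ {occ a f} → a ≤ n → a ∈ occ → firstFree n occ a (suc f) ≡ firstFree n occ (suc a) f
  firstFree-skip {occ} {a} a≤n a∈occ rewrite dec-true (a ≤? n) a≤n | dec-true (a ∈? occ) a∈occ = refl

  firstFree-finds : ∀ k {occ a f} → k < f → a + k ≤ n → (∀ t → t < k → a + t ∈ occ) → a + k ∉ occ →
                    firstFree n occ a f ≡ just (a + k)
  firstFree-finds zero {a = a} {suc f} _ a+0≤n _ a+0∉occ
    rewrite +-identityʳ a = firstFree-here {f = f} a+0≤n a+0∉occ
  firstFree-finds (suc k) {occ} {a} {suc f} (s≤s k<f) a+k≤n taken a+k∉occ = begin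
    firstFree n occ a (suc f)   ≡⟨ firstFree-skip {f = f} (≤-trans (m≤m+n a (suc k)) a+k≤n) a∈occ ⟩
    firstFree n occ (suc a) f   ≡⟨ firstFree-finds k {f = f} k<f (subst (_≤ n) (+-suc a k) a+k≤n) taken′
                                                    (subst (_∉ occ) (+-suc a k) a+k∉occ) ⟩
    just (suc a + k)            ≡⟨ cong just (+-suc a k) ⟨
    just (a + suc k)            ∎
    where
    open ≡-Reasoning
    a∈occ : a ∈ occ
    a∈occ = subst (_∈ occ) (+-identityʳ a) (taken 0 z<s)
    taken′ : ∀ t → t < k → suc a + t ∈ occ
    taken′ t t<k = subst (_∈ occ) (+-suc a t) (taken (suc t) (s≤s t<k))

  parkFrom-∷ : ∀ {occ a s} (S : Vec ℕ m) → firstFree n occ a (suc n) ≡ just s →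
               parkFrom n occ (a ∷ S) ≡ just s ∷ parkFrom n (s ∷ occ) S
  parkFrom-∷ {occ = occ} {a = a} S found with firstFree n occ a (suc n)
  parkFrom-∷ S refl | just _ = refl

module Parking {n : ℕ} {M : ℕ → ℕ} (layout : BlockLayout n M) where

  open BlockLayout layout

  firstFree-next : ∀ {occ a seen} → multiplicity a seen < M a → (∀ p → multiplicity p seen ≤ M p) →
                   (∀ s → s ∈ occ ⇔ Occupied seen s) → firstFree n occ a (suc n) ≡ just (a + multiplicity a seen)
  firstFree-next {occ} {a} {seen} c<M seen≤M occupied =
    firstFree-finds c (s≤s (≤-trans (m≤n+m c a) a+c≤n)) a+c≤n taken free
    where
    c = multiplicity a seen
    a+c≤n : a + c ≤ n
    a+c≤n = s≤s⁻¹ (≤-trans (+-monoʳ-< a c<M) (block-fits (≤-<-trans z≤n c<M)))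
    taken : ∀ t → t < c → a + t ∈ occ
    taken t t<c = from (occupied (a + t)) (a , m≤m+n a t , +-monoʳ-< a t<c)
    free : a + c ∉ occ
    free a+c∈occ with to (occupied (a + c)) a+c∈occ
    ... | p , p≤a+c , a+c<p+k
      with blocks-disjoint (p≤a+c , <-≤-trans a+c<p+k (+-monoʳ-≤ p (seen≤M p))) (m≤m+n a c , +-monoʳ-< a c<M)
    ...   | refl = n≮n (a + c) a+c<p+k

  parkFrom-blockSpots : ∀ {seen occ} (S : Vec ℕ m) →
    (∀ q → multiplicity q seen + multiplicity q (toList S) ≡ M q) →
    (∀ s → s ∈ occ ⇔ Occupied seen s) →
    parkFrom n occ S ≡ blockSpots seen S
  parkFrom-blockSpots [] _ _ = refl
  parkFrom-blockSpots {seen = seen} {occ} (a ∷ S) total occupied = begin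
    parkFrom n occ (a ∷ S)
      ≡⟨ parkFrom-∷ {a = a} S (firstFree-next {a = a} {seen} c<M seen≤M occupied) ⟩
    just (a + c) ∷ parkFrom n ((a + c) ∷ occ) S
      ≡⟨ cong (just (a + c) ∷_) (parkFrom-blockSpots S total′ occupied′) ⟩
    blockSpots seen (a ∷ S)
      ∎
    where
    open ≡-Reasoning
    c = multiplicity a seen
    c<M : c < M a
    c<M = subst (c <_) (total a) (subst (λ k → c < c + k) (sym (multiplicity-∷-≡ a (toList S))) (m<m+n c z<s))
    seen≤M : ∀ p → multiplicity p seen ≤ M p
    seen≤M p = subst (_ ≤_) (total p) (m≤m+n _ _)
    total′ : ∀ q → multiplicity q (a ∷ seen) + multiplicity q (toList S) ≡ M q
    total′ q = trans (multiplicity-move q a seen (toList S)) (total q)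
    occupied′ : ∀ s → s ∈ (a + c) ∷ occ ⇔ Occupied (a ∷ seen) s
    occupied′ s = mk⇔
      (λ { (here s≡a+c)  → to occupied-∷ (inj₁ s≡a+c)
         ; (there s∈occ) → to occupied-∷ (inj₂ (to (occupied s) s∈occ)) })
      (λ occ′ → [ here , there ∘ from (occupied s) ]′ (from occupied-∷ occ′))

  parking-blockSpots : ∀ {α : Vec ℕ n} → (∀ q → multiplicity q (toList α) ≡ M q) → parking α ≡ blockSpots [] α
  parking-blockSpots {α} total = parkFrom-blockSpots α total λ s →
    mk⇔ (λ ()) (λ (_ , inP) → contradiction (InRange⇒0< inP) (n≮n 0))

∉-∷⇔ : ∀ {x a : ℕ} {xs} → x ∉ a ∷ xs ⇔ (x ≢ a × x ∉ xs)
∉-∷⇔ = mk⇔ (λ x∉ → x∉ ∘ here , x∉ ∘ there)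
           (λ { (x≢a , _) (here x≡a) → x≢a x≡a ; (_ , x∉xs) (there x∈xs) → x∉xs x∈xs })

unshifted⇔∉ : ∀ {a seen} → just (a + multiplicity a seen) ≡ just a ⇔ a ∉ seen
unshifted⇔∉ {a} {seen} = mk⇔
  (λ eq → to multiplicity≡0⇔∉ (+-cancelˡ-≡ a _ 0 (trans (just-injective eq) (sym (+-identityʳ a)))))
  (λ a∉seen → cong just (trans (cong (a +_) (from multiplicity≡0⇔∉ a∉seen)) (+-identityʳ a)))

Fresh : List ℕ → Vec ℕ m → Fin m → Set
Fresh seen S i = lookup S i ∉ seen × (∀ j → j <ᶠ i → lookup S i ≢ lookup S j)

Fresh-∷ : ∀ {a seen} (S : Vec ℕ m) i → Fresh (a ∷ seen) S i ⇔ Fresh seen (a ∷ S) (fsuc i)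
Fresh-∷ S i = mk⇔
  (λ (x∉a∷seen , earlier) → let (x≢a , x∉seen) = to ∉-∷⇔ x∉a∷seen in
     x∉seen , λ { fzero _ → x≢a ; (fsuc j) (s≤s j<i) → earlier j j<i })
  (λ (x∉seen , earlier) → from ∉-∷⇔ (earlier fzero z<s , x∉seen) , λ j j<i → earlier (fsuc j) (s≤s j<i))

lookup-blockSpots : ∀ seen (S : Vec ℕ m) i → lookup (blockSpots seen S) i ≡ just (lookup S i) ⇔ Fresh seen S i
lookup-blockSpots seen (a ∷ S) fzero =
  mk⇔ (λ unshifted → to unshifted⇔∉ unshifted , λ _ ()) (from unshifted⇔∉ ∘ proj₁)
lookup-blockSpots seen (a ∷ S) (fsuc i) = ⇔.trans (lookup-blockSpots (a ∷ seen) S i) (Fresh-∷ S i)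

luckyCount : Vec (Maybe ℕ) m → Vec ℕ m → ℕ
luckyCount {m} v S = count (λ i → ≡-dec _≟_ (lookup v i) (just (lookup S i))) (allFin m)

luckyCount-blockSpots : ∀ seen (S : Vec ℕ m) →
  luckyCount (blockSpots seen S) S ≡ count (_∉? seen) (deduplicate _≟_ (toList S))
luckyCount-blockSpots seen [] = refl
luckyCount-blockSpots {suc m} seen (a ∷ S) =
  count-∷-cong P? (_∉? seen) {fzero} {a} {tabulate fsuc} (does-⇔ unshifted⇔∉ (P? fzero) (a ∉? seen)) (begin
  count P? (tabulate fsuc)                     ≡⟨ cong (count P?) (List.map-tabulate id fsuc) ⟨
  count P? (map fsuc (allFin m))               ≡⟨ count-map P? fsuc (allFin m) ⟩
  luckyCount (blockSpots (a ∷ seen) S) S       ≡⟨ luckyCount-blockSpots (a ∷ seen) S ⟩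
  count (_∉? a ∷ seen) D                       ≡⟨ cong length (List.filter-≐ _ _ new≐ D) ⟨
  count ((_∉? seen) ∩? (¬? ∘ (a ≟_))) D        ≡⟨ count-filter (_∉? seen) (¬? ∘ (a ≟_)) D ⟨
  count (_∉? seen) (filter (¬? ∘ (a ≟_)) D)    ∎)
  where
  open ≡-Reasoning
  D = deduplicate _≟_ (toList S)
  P? = λ i → ≡-dec _≟_ (lookup (blockSpots seen (a ∷ S)) i) (just (lookup (a ∷ S) i))
  new≐ : (λ x → x ∉ seen × a ≢ x) ≐ (_∉ a ∷ seen)
  new≐ = (λ (x∉seen , a≢x) → from ∉-∷⇔ (≢-sym a≢x , x∉seen))
       , (λ x∉a∷seen → let (x≢a , x∉seen) = to ∉-∷⇔ x∉a∷seen in x∉seen , ≢-sym x≢a)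

theorem2p3 : (n : ℕ) → 1 ≤ n → (α : Vec ℕ n) → IsFubini n α →
    (∀ (i : Fin n) → Lucky α i ⇔ (∀ (j : Fin n) → j <ᶠ i → lookup α i ≢ lookup α j))
    × (lucky α ≡ distinctValues α)
theorem2p3 n _ α fubini = lucky⇔new , lucky≡distinct
  where
  parked : parking α ≡ blockSpots [] α
  parked = Parking.parking-blockSpots (fubini-blockLayout {α = α} fubini) {α} (λ _ → refl)

  lucky⇔new : ∀ i → Lucky α i ⇔ (∀ j → j <ᶠ i → lookup α i ≢ lookup α j)
  lucky⇔new i = ⇔.trans
    (subst (λ v → lookup v i ≡ just (lookup α i) ⇔ Fresh [] α i) (sym parked) (lookup-blockSpots [] α i))
    (mk⇔ proj₂ (λ earlier → (λ ()) , earlier))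

  lucky≡distinct : lucky α ≡ distinctValues α
  lucky≡distinct = begin
    luckyCount (parking α) α         ≡⟨ cong (λ v → luckyCount v α) parked ⟩
    luckyCount (blockSpots [] α) α   ≡⟨ luckyCount-blockSpots [] α ⟩
    count (_∉? []) values            ≡⟨ cong length (List.filter-all (_∉? []) (universal (λ _ ()) values)) ⟩
    length values                    ∎
    where
    open ≡-Reasoning
    values = deduplicate _≟_ (toList α)
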